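{- Let $a,b,c$ be positive integers, let $m=a+b+1$, and suppose $c\le \tau_0:=\lfloor(1+\sqrt{2})(m-\tfrac{3}{2})\rfloor-1$. Consider the graph $S_{a,b}+cP_3$, where $u_1,\dots,u_c$ are the middle vertices of the $c$ copies of $P_3$, and $u_{c+1}$, $u_{c+2}$ are the endpoints of the internal edge of $S_{a,b}$, incident to $a$ and $b$ pendant edges respectively; let $e_I=u_{c+1}u_{c+2}$. If $f:E(S_{a,b}+cP_3)\to\{1,2,\dots,m+2c\}$ is a bijection such that \[ \{\phi(u_1),\phi(u_2),\dots,\phi(u_{c+1})\}=\{f(e_I)\}\cup\{m+2c+1,m+2c+2,\dots,m+3c\}, \] then $f$ is an antimagic labeling of $S_{a,b}+cP_3$.
   Context: For an edge labeling $f$ of a graph, the vertex sum of a vertex $v$ is $\phi(v)=\sum_{e\ni v} f(e)$. An antimagic labeling of a graph with $m'$ edges is a bijection from the edge set to $\{1,\dots,m'\}$ whose vertex sums are pairwise distinct. $G+cP_3$ denotes the disjoint union of $G$ with $c$ copies of the path $P_3$ on 3 vertices. The double star $S_{a,b}$ is the tree consisting of an edge (the internal edge) together with $a$ pendant edges attached at one of its endpoints and $b$ pendant edges attached at the other. -}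

module Defs where

open import Data.Nat using (ℕ; zero; suc; _+_; _*_; _∸_; _≤_; _≤?_; _/_)
open import Data.Nat.Properties using ()
open import Data.Fin using (Fin)
import Data.Fin as F
open import Data.List using (List; []; _∷_; _++_; map; filter; allFin)
open import Data.Nat.ListAction using (sum)
open import Data.Product using (_×_; _,_; proj₁; proj₂; ∃-syntax)
open import Data.Sum using (_⊎_)
open import Relation.Nullary using (Dec; yes; no; ¬_)
open import Relation.Nullary.Decidable using (_⊎-dec_)
open import Relation.Binary.PropositionalEquality using (_≡_; refl; cong; cong₂)
open import Function.Definitions using (Injective)

-- The graph S_{a,b} + c P_3
--   mid i        : u_{i+1}, middle vertex of the (i+1)-th copy of P_3
--   leafP i j    : the two end vertices of the (i+1)-th copy of P_3
--   hubA         : u_{c+1}, endpoint of the internal edge with a pendant edges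
--   hubB         : u_{c+2}, endpoint of the internal edge with b pendant edges
--   leafA k / leafB k : the pendant leaves

data Vertex (a b c : ℕ) : Set where
  mid   : Fin c → Vertex a b c
  leafP : Fin c → Fin 2 → Vertex a b c
  hubA  : Vertex a b c
  hubB  : Vertex a b c
  leafA : Fin a → Vertex a b c
  leafB : Fin b → Vertex a b c

data Edge (a b c : ℕ) : Set where
  pEdge : Fin c → Fin 2 → Edge a b c
  eI    : Edge a b c
  aEdge : Fin a → Edge a b c
  bEdge : Fin b → Edge a b c

ends : ∀ {a b c} → Edge a b c → Vertex a b c × Vertex a b c
ends (pEdge i j) = mid i , leafP i j
ends eI          = hubA , hubB
ends (aEdge k)   = hubA , leafA k
ends (bEdge k)   = hubB , leafB k

allEdges : ∀ a b c → List (Edge a b c)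
allEdges a b c =
  (Data.List.concatMap (λ i → map (pEdge i) (allFin 2)) (allFin c))
  ++ (eI ∷ (map aEdge (allFin a) ++ map bEdge (allFin b)))

_≟V_ : ∀ {a b c} (u v : Vertex a b c) → Dec (u ≡ v)
mid i ≟V mid j with i F.≟ j
... | yes refl = yes refl
... | no p = no λ { refl → p refl }
leafP i j ≟V leafP k l with i F.≟ k | j F.≟ l
... | yes refl | yes refl = yes refl
... | no p | _ = no λ { refl → p refl }
... | _ | no p = no λ { refl → p refl }
hubA ≟V hubA = yes refl
hubB ≟V hubB = yes refl
leafA i ≟V leafA j with i F.≟ j
... | yes refl = yes refl
... | no p = no λ { refl → p refl }
leafB i ≟V leafB j with i F.≟ j
... | yes refl = yes refl
... | no p = no λ { refl → p refl }
mid _ ≟V leafP _ _ = no λ ()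
mid _ ≟V hubA = no λ ()
mid _ ≟V hubB = no λ ()
mid _ ≟V leafA _ = no λ ()
mid _ ≟V leafB _ = no λ ()
leafP _ _ ≟V mid _ = no λ ()
leafP _ _ ≟V hubA = no λ ()
leafP _ _ ≟V hubB = no λ ()
leafP _ _ ≟V leafA _ = no λ ()
leafP _ _ ≟V leafB _ = no λ ()
hubA ≟V mid _ = no λ ()
hubA ≟V leafP _ _ = no λ ()
hubA ≟V hubB = no λ ()
hubA ≟V leafA _ = no λ ()
hubA ≟V leafB _ = no λ ()
hubB ≟V mid _ = no λ ()
hubB ≟V leafP _ _ = no λ ()
hubB ≟V hubA = no λ ()
hubB ≟V leafA _ = no λ ()
hubB ≟V leafB _ = no λ ()
leafA _ ≟V mid _ = no λ ()
leafA _ ≟V leafP _ _ = no λ ()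
leafA _ ≟V hubA = no λ ()
leafA _ ≟V hubB = no λ ()
leafA _ ≟V leafB _ = no λ ()
leafB _ ≟V mid _ = no λ ()
leafB _ ≟V leafP _ _ = no λ ()
leafB _ ≟V hubA = no λ ()
leafB _ ≟V hubB = no λ ()
leafB _ ≟V leafA _ = no λ ()

Incident : ∀ {a b c} → Vertex a b c → Edge a b c → Set
Incident v e = v ≡ proj₁ (ends e) ⊎ v ≡ proj₂ (ends e)

incident? : ∀ {a b c} (v : Vertex a b c) (e : Edge a b c) → Dec (Incident v e)
incident? v e = (v ≟V proj₁ (ends e)) ⊎-dec (v ≟V proj₂ (ends e))

φ : ∀ {a b c} → (Edge a b c → ℕ) → Vertex a b c → ℕ
φ {a} {b} {c} f v = sum (map f (filter (incident? v) (allEdges a b c)))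

IsBijectionOnto1to : ∀ {a b c} → ℕ → (Edge a b c → ℕ) → Set
IsBijectionOnto1to N f =
  Injective _≡_ _≡_ f
  × (∀ e → 1 ≤ f e × f e ≤ N)
  × (∀ k → 1 ≤ k → k ≤ N → ∃[ e ] f e ≡ k)

IsAntimagic : ∀ a b c → (Edge a b c → ℕ) → Set
IsAntimagic a b c f =
  IsBijectionOnto1to ((a + b + 1) + 2 * c) f
  × (∀ u v → φ f u ≡ φ f v → u ≡ v)

-- τ₀ = ⌊(1+√2)(m - 3/2)⌋ - 1.
-- With k = 2m - 3:  (1+√2)(m-3/2) = (k + √(2k²))/2, and for integer k and
-- real x ≥ 0, ⌊(k + x)/2⌋ = ⌊(k + ⌊x⌋)/2⌋.  So
--   τ₀ = ⌊(k + isqrt(2k²)) / 2⌋ - 1.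

isqrtFrom : ℕ → ℕ → ℕ
isqrtFrom n zero = zero
isqrtFrom n (suc r) with suc r * suc r ≤? n
... | yes _ = suc r
... | no _  = isqrtFrom n r

isqrt : ℕ → ℕ
isqrt n = isqrtFrom n n

τ₀ : ℕ → ℕ
τ₀ m = ((k + isqrt (2 * k * k)) / 2) ∸ 1
  where k = 2 * m ∸ 3

-- The c + 1 vertex sums φ(u₁), …, φ(u_{c+1}) take every value of the target set
-- T = {f(e_I)} ∪ [N + 1, N + c], where N = m + 2c, and T has exactly c + 1 elements;
-- so these sums are pairwise distinct and add up to ΣT. Summing φ over the non-leaf
-- vertices counts f(e_I) twice and every other label once, which gives
-- φ(u_{c+2}) = (1 + ⋯ + N) − ((N + 1) + ⋯ + (N + c)). This exceeds N + c exactly when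
-- m² + 2mc > c² + m + 5c + 1, and that follows from c ≤ τ₀. Each leaf's sum is the label
-- of its pendant edge: at most N and not f(e_I). So sums of leaves, sums of u₁, …, u_{c+1},
-- and the sum of u_{c+2} lie in disjoint ranges.
module Submission where

open import Defs
open import Data.Bool using (true; false; if_then_else_)
open import Data.Nat using (ℕ; zero; suc; _+_; _*_; _∸_; _/_; _≤_; _<_; _≤?_; s≤s; z≤n; z<s)
open import Data.Nat.Properties
open import Data.Nat.DivMod using (m/n*n≤m)
open import Data.Nat.Tactic.RingSolver using (solve-∀)
open import Data.Nat.ListAction using (sum)
open import Data.Nat.ListAction.Properties using (sum-++; sum-↭)
open import Data.Fin using (Fin; zero; suc; punchIn; punchOut)
open import Data.Fin.Patterns using (0F; 1F)
open import Data.Fin.Properties using (punchIn-punchOut; punchInᵢ≢i) renaming (_≟_ to _≟ᶠ_)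
open import Data.List using (List; []; _∷_; _++_; length; map; filter; concatMap; tabulate; allFin)
open import Data.List.Properties using (length-++; length-tabulate; map-++; map-tabulate; map-∘)
open import Data.List.Membership.Propositional using (_∈_; lose)
open import Data.List.Membership.Propositional.Properties
  using (∈-∃++; ∈-tabulate⁺; ∈-tabulate⁻; ∈-++⁺ˡ; ∈-++⁺ʳ; ∈-map⁺; ∈-allFin; ∈-concatMap⁺)
open import Data.List.Relation.Binary.Subset.Propositional using (_⊆_)
open import Data.List.Relation.Binary.Permutation.Propositional using (_↭_; ↭-refl; ↭-trans; ↭-prep)
open import Data.List.Relation.Binary.Permutation.Propositional.Properties using (shift; ∈-resp-↭; ↭-length)
open import Data.List.Relation.Unary.Any using (here; there)
import Data.List.Relation.Unary.All as All
open import Data.List.Relation.Unary.AllPairs using ([]; _∷_)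
open import Data.List.Relation.Unary.Unique.Propositional using (Unique)
import Data.List.Relation.Unary.Unique.Propositional.Properties as Unique
open import Data.Product using (_×_; _,_; proj₁; proj₂; ∃-syntax)
open import Data.Sum using (_⊎_; inj₁; inj₂)
open import Data.Vec.Functional using (Vector)
open import Function using (_∘_; id)
open import Function.Definitions using (Injective)
open import Relation.Nullary using (¬_; does; yes; no; contradiction)
open import Relation.Nullary.Decidable using (dec-true; dec-false)
open import Relation.Unary using (Pred; Decidable)
open import Relation.Binary.PropositionalEquality
open import Algebra.Properties.CommutativeMonoid.Sum +-0-commutativeMonoid
  using (sum-remove; sum-cong-≗; sum-replicate-zero) renaming (sum to ∑)

module _ {A : Set} where

  unique∧⊆⇒↭++ : {xs ys : List A} → Unique xs → xs ⊆ ys → ∃[ zs ] ys ↭ xs ++ zs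
  unique∧⊆⇒↭++ {[]}     {ys} _ _ = ys , ↭-refl
  unique∧⊆⇒↭++ {x ∷ xs} {ys} (x∉xs ∷ xs!) xs⊆ys with ∈-∃++ (xs⊆ys (here refl))
  ... | ys₁ , ys₂ , refl =
    let zs , ys₁++ys₂↭xs++zs = unique∧⊆⇒↭++ xs! xs⊆ys₁++ys₂
    in  zs , ↭-trans (shift x ys₁ ys₂) (↭-prep x ys₁++ys₂↭xs++zs)
    where
    xs⊆ys₁++ys₂ : xs ⊆ ys₁ ++ ys₂
    xs⊆ys₁++ys₂ z∈xs with ∈-resp-↭ (shift x ys₁ ys₂) (xs⊆ys (there z∈xs))
    ... | here z≡x = contradiction (sym z≡x) (All.lookup x∉xs z∈xs)
    ... | there z∈ = z∈

  length-mono-⊆ : {xs ys : List A} → Unique xs → xs ⊆ ys → length xs ≤ length ys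
  length-mono-⊆ {xs} xs! xs⊆ys with zs , ys↭xs++zs ← unique∧⊆⇒↭++ xs! xs⊆ys =
    subst (length xs ≤_) (trans (sym (length-++ xs)) (sym (↭-length ys↭xs++zs))) (m≤m+n _ _)

  -- A pigeonhole principle: g cannot hit n distinct values while repeating one.
  unique-⊆-tabulate⇒injective : ∀ {n} (g : Fin n → A) {ys : List A} → Unique ys → n ≤ length ys →
                                ys ⊆ tabulate g → Injective _≡_ _≡_ g
  unique-⊆-tabulate⇒injective {suc n} g {ys} ys! n≤|ys| ys⊆g {i} {j} gi≡gj with i ≟ᶠ j
  ... | yes i≡j = i≡j
  ... | no i≢j  = contradiction (length-mono-⊆ ys! ys⊆g∘punchIn) (<⇒≱ (begin-strict
      length (tabulate (g ∘ punchIn j)) ≡⟨ length-tabulate (g ∘ punchIn j) ⟩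
      n                                 <⟨ n<1+n n ⟩
      suc n                             ≤⟨ n≤|ys| ⟩
      length ys                         ∎))
    where
    open ≤-Reasoning
    avoid-j : ∀ k → ∃[ l ] g (punchIn j l) ≡ g k
    avoid-j k with k ≟ᶠ j
    ... | yes refl = punchOut (i≢j ∘ sym) , trans (cong g (punchIn-punchOut (i≢j ∘ sym))) gi≡gj
    ... | no k≢j   = punchOut (k≢j ∘ sym) , cong g (punchIn-punchOut (k≢j ∘ sym))
    ys⊆g∘punchIn : ys ⊆ tabulate (g ∘ punchIn j)
    ys⊆g∘punchIn y∈ys with k , y≡gk ← ∈-tabulate⁻ {f = g} (ys⊆g y∈ys) with l , gl≡gk ← avoid-j k =
      subst (_∈ tabulate (g ∘ punchIn j)) (trans gl≡gk (sym y≡gk)) (∈-tabulate⁺ l)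

sum-mono-⊆ : {xs ys : List ℕ} → Unique xs → xs ⊆ ys → sum xs ≤ sum ys
sum-mono-⊆ {xs} xs! xs⊆ys with zs , ys↭xs++zs ← unique∧⊆⇒↭++ xs! xs⊆ys =
  subst (sum xs ≤_) (trans (sym (sum-++ xs zs)) (sym (sum-↭ ys↭xs++zs))) (m≤m+n _ _)

sum-map-++ : ∀ {A : Set} (h : A → ℕ) xs ys → sum (map h (xs ++ ys)) ≡ sum (map h xs) + sum (map h ys)
sum-map-++ h xs ys = trans (cong sum (map-++ h xs ys)) (sum-++ (map h xs) (map h ys))

sum-map-filter : ∀ {A : Set} {p} {P : Pred A p} (P? : Decidable P) (h : A → ℕ) xs →
                 sum (map h (filter P? xs)) ≡ sum (map (λ x → if does (P? x) then h x else 0) xs)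
sum-map-filter P? h []       = refl
sum-map-filter P? h (x ∷ xs) with does (P? x)
... | true  = cong (h x +_) (sum-map-filter P? h xs)
... | false = sum-map-filter P? h xs

sum-map-concatMap : ∀ {A B : Set} (h : B → ℕ) (g : A → List B) xs →
                    sum (map h (concatMap g xs)) ≡ sum (map (sum ∘ map h ∘ g) xs)
sum-map-concatMap h g []       = refl
sum-map-concatMap h g (x ∷ xs) =
  trans (sum-map-++ h (g x) (concatMap g xs)) (cong (_ +_) (sum-map-concatMap h g xs))

sum-tabulate : ∀ {n} (t : Vector ℕ n) → sum (tabulate t) ≡ ∑ t
sum-tabulate {zero}  t = refl
sum-tabulate {suc n} t = cong (t zero +_) (sum-tabulate (t ∘ suc))

sum-map-allFin : ∀ {n} (t : Vector ℕ n) → sum (map t (allFin n)) ≡ ∑ t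
sum-map-allFin t = trans (cong sum (map-tabulate id t)) (sum-tabulate t)

∑-single : ∀ {n} (t : Vector ℕ n) k → (∀ i → i ≢ k → t i ≡ 0) → ∑ t ≡ t k
∑-single {suc n} t k t≡0 = begin
  ∑ t                     ≡⟨ sum-remove {i = k} t ⟩
  t k + ∑ (t ∘ punchIn k) ≡⟨ cong (t k +_) (sum-cong-≗ (λ i → t≡0 _ (punchInᵢ≢i k i))) ⟩
  t k + ∑ {n} (λ _ → 0)   ≡⟨ cong (t k +_) (sum-replicate-zero n) ⟩
  t k + 0                 ≡⟨ +-identityʳ (t k) ⟩
  t k                     ∎
  where open ≡-Reasoning

+-cong₃ : ∀ {x x′ y y′ z z′ : ℕ} → x ≡ x′ → y ≡ y′ → z ≡ z′ →
          x + (y + z) ≡ x′ + (y′ + z′)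
+-cong₃ refl refl refl = refl

range : ℕ → ℕ → List ℕ
range s zero    = []
range s (suc n) = s ∷ range (suc s) n

length-range : ∀ s n → length (range s n) ≡ n
length-range s zero    = refl
length-range s (suc n) = cong suc (length-range (suc s) n)

∈-range⁻ : ∀ {s n k} → k ∈ range s n → s ≤ k × k < s + n
∈-range⁻ {s} {suc n}     (here refl) = ≤-refl , m<m+n s z<s
∈-range⁻ {s} {suc n} {k} (there k∈) with s<k , k<s+n ← ∈-range⁻ k∈ =
  <⇒≤ s<k , subst (k <_) (sym (+-suc s n)) k<s+n

∈-range⁺ : ∀ {s n k} → s ≤ k → k < s + n → k ∈ range s n
∈-range⁺ {s} {zero}      s≤k k<s+n = contradiction (subst (_ <_) (+-identityʳ s) k<s+n) (≤⇒≯ s≤k)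
∈-range⁺ {s} {suc n} {k} s≤k k<s+n with s ≟ k
... | yes refl = here refl
... | no s≢k   = there (∈-range⁺ (≤∧≢⇒< s≤k s≢k) (subst (k <_) (+-suc s n) k<s+n))

range-unique : ∀ s n → Unique (range s n)
range-unique s zero    = []
range-unique s (suc n) =
  All.tabulate (λ k∈ → <⇒≢ (proj₁ (∈-range⁻ k∈))) ∷ range-unique (suc s) n

sum-range : ∀ s n → 2 * sum (range s n) + n ≡ n * (2 * s + n)
sum-range s zero    = refl
sum-range s (suc n) = begin
  2 * (s + σ) + suc n              ≡⟨ regroup s n σ ⟩
  2 * s + 1 + (2 * σ + n)          ≡⟨ cong (2 * s + 1 +_) (sum-range (suc s) n) ⟩
  2 * s + 1 + n * (2 * suc s + n)  ≡⟨ expand s n ⟩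
  suc n * (2 * s + suc n)          ∎
  where
  open ≡-Reasoning
  σ : ℕ
  σ = sum (range (suc s) n)
  regroup : ∀ s n σ → 2 * (s + σ) + suc n ≡ 2 * s + 1 + (2 * σ + n)
  regroup = solve-∀
  expand : ∀ s n → 2 * s + 1 + n * (2 * suc s + n) ≡ suc n * (2 * s + suc n)
  expand = solve-∀

-- Arithmetic consequences of c ≤ τ₀

m+o≡n+p∧p≤o⇒m≤n : ∀ {m n o p} → m + o ≡ n + p → p ≤ o → m ≤ n
m+o≡n+p∧p≤o⇒m≤n {m} {n} {o} {p} eq p≤o = +-cancelʳ-≤ p m n (begin
  m + p ≤⟨ +-monoʳ-≤ m p≤o ⟩
  m + o ≡⟨ eq ⟩
  n + p ∎)
  where open ≤-Reasoning

isqrtFrom-square≤ : ∀ n r → isqrtFrom n r * isqrtFrom n r ≤ n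
isqrtFrom-square≤ n zero    = z≤n
isqrtFrom-square≤ n (suc r) with suc r * suc r ≤? n
... | yes r²≤n = r²≤n
... | no _     = isqrtFrom-square≤ n r

isqrt-square≤ : ∀ n → isqrt n * isqrt n ≤ n
isqrt-square≤ n = isqrtFrom-square≤ n n

-- For s ≤ √2·k this is: t ≤ (1 + √2) k implies t² ≤ 2tk + k².
square≤ : ∀ k s t → t ≤ k + s → s * s ≤ 2 * k * k → t * t ≤ 2 * t * k + k * k
square≤ k s t t≤k+s s²≤2k² with t ≤? k
... | yes t≤k = ≤-trans (*-mono-≤ t≤k t≤k) (m≤n+m (k * k) (2 * t * k))
... | no t≰k with d , refl ← m≤n⇒∃[o]m+o≡n (<⇒≤ (≰⇒> t≰k)) =
  m+o≡n+p∧p≤o⇒m≤n (expand k d) (≤-trans (*-mono-≤ d≤s d≤s) s²≤2k²)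
  where
  d≤s : d ≤ s
  d≤s = +-cancelˡ-≤ k d s t≤k+s
  expand : ∀ k d → (k + d) * (k + d) + 2 * k * k ≡ 2 * (k + d) * k + k * k + d * d
  expand = solve-∀

τ₀-bound : ∀ m c → 1 ≤ c → c ≤ τ₀ m →
           2 * c + 2 ≤ (2 * m ∸ 3) + isqrt (2 * (2 * m ∸ 3) * (2 * m ∸ 3))
τ₀-bound m c 1≤c c≤τ₀ = begin
  2 * c + 2             ≡⟨ *-distribˡ-+ 2 c 1 ⟨
  2 * (c + 1)           ≤⟨ *-monoʳ-≤ 2 (m≤o∸n⇒m+n≤o c 1≤q c≤τ₀) ⟩
  2 * q                 ≡⟨ *-comm 2 q ⟩
  q * 2                 ≤⟨ m/n*n≤m (k + isqrt (2 * k * k)) 2 ⟩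
  k + isqrt (2 * k * k) ∎
  where
  open ≤-Reasoning
  k q : ℕ
  k = 2 * m ∸ 3
  q = (k + isqrt (2 * k * k)) / 2
  1≤q : 1 ≤ q
  1≤q = ≤-trans 1≤c (≤-trans c≤τ₀ (m∸n≤m q 1))

-- square≤ with k = 2m − 3 = 2n + 1 and t = 2(c + 1).
τ₀-quadratic : ∀ m c → 2 ≤ m → 1 ≤ c → c ≤ τ₀ m → c * c + m + 5 * c + 1 < m * m + 2 * m * c
τ₀-quadratic m@(suc (suc n)) c (s≤s (s≤s _)) 1≤c c≤τ₀ = *-cancelˡ-< 4 _ _ (begin-strict
  4 * (c * c + m + 5 * c + 1)     <⟨ m<m+n _ {3} z<s ⟩
  4 * (c * c + m + 5 * c + 1) + 3 ≤⟨ m+o≡n+p∧p≤o⇒m≤n (expand n c) t²≤2tk+k² ⟩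
  4 * (m * m + 2 * m * c)         ∎)
  where
  open ≤-Reasoning
  k≡1+2n : 2 * m ∸ 3 ≡ 1 + 2 * n
  k≡1+2n = trans (cong (_∸ 3) (double n)) (m+n∸m≡n 3 (1 + 2 * n))
    where
    double : ∀ n → 2 * suc (suc n) ≡ 3 + (1 + 2 * n)
    double = solve-∀
  t²≤2tk+k² : (2 * c + 2) * (2 * c + 2) ≤ 2 * (2 * c + 2) * (1 + 2 * n) + (1 + 2 * n) * (1 + 2 * n)
  t²≤2tk+k² = subst (λ k → (2 * c + 2) * (2 * c + 2) ≤ 2 * (2 * c + 2) * k + k * k) k≡1+2n
    (square≤ _ _ _ (τ₀-bound m c 1≤c c≤τ₀) (isqrt-square≤ _))
  expand : ∀ n c → 4 * (c * c + suc (suc n) + 5 * c + 1) + 3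
                     + (2 * (2 * c + 2) * (1 + 2 * n) + (1 + 2 * n) * (1 + 2 * n))
                 ≡ 4 * (suc (suc n) * suc (suc n) + 2 * suc (suc n) * c) + (2 * c + 2) * (2 * c + 2)
  expand = solve-∀

range-gap : ∀ m c → let N = m + 2 * c in
            c * c + m + 5 * c + 1 < m * m + 2 * m * c →
            sum (range (suc N) c) + (N + c) < sum (range 1 N)
range-gap m c quadratic = *-cancelˡ-≤ 2 (+-cancelʳ-≤ (N + c) _ _ (begin
  2 * suc (σ₂ + (N + c)) + (N + c)          ≡⟨ regroup σ₂ N c ⟩
  (2 * σ₂ + c) + (3 * N + 2 * c + 2)        ≡⟨ cong (_+ (3 * N + 2 * c + 2)) (sum-range (suc N) c) ⟩
  c * (2 * suc N + c) + (3 * N + 2 * c + 2) ≤⟨ m+o≡n+p∧p≤o⇒m≤n (expand m c) quadratic ⟩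
  N * (2 * 1 + N) + c                       ≡⟨ cong (_+ c) (sum-range 1 N) ⟨
  (2 * σ₁ + N) + c                          ≡⟨ +-assoc (2 * σ₁) N c ⟩
  2 * σ₁ + (N + c)                          ∎))
  where
  open ≤-Reasoning
  N σ₁ σ₂ : ℕ
  N = m + 2 * c
  σ₁ = sum (range 1 N)
  σ₂ = sum (range (suc N) c)
  regroup : ∀ σ N c → 2 * suc (σ + (N + c)) + (N + c) ≡ (2 * σ + c) + (3 * N + 2 * c + 2)
  regroup = solve-∀
  expand : ∀ m c → c * (2 * suc (m + 2 * c) + c) + (3 * (m + 2 * c) + 2 * c + 2) + (m * m + 2 * m * c)
                 ≡ (m + 2 * c) * (2 * 1 + (m + 2 * c)) + c + suc (c * c + m + 5 * c + 1)
  expand = solve-∀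

-- The target set {t} ∪ [m + 2c + 1, m + 3c]

module _ (m c t : ℕ) where

  private
    m+3c≡m+2c+c : ∀ m c → m + 3 * c ≡ m + 2 * c + c
    m+3c≡m+2c+c = solve-∀

  ∈-target⁺ : ∀ {x} → x ≡ t ⊎ (m + 2 * c + 1 ≤ x × x ≤ m + 3 * c) → x ∈ t ∷ range (suc (m + 2 * c)) c
  ∈-target⁺ (inj₁ refl)          = here refl
  ∈-target⁺ {x} (inj₂ (lo , hi)) =
    there (∈-range⁺ (subst (_≤ x) (+-comm (m + 2 * c) 1) lo) (s≤s (subst (x ≤_) (m+3c≡m+2c+c m c) hi)))

  ∈-target⁻ : ∀ {x} → x ∈ t ∷ range (suc (m + 2 * c)) c → x ≡ t ⊎ (m + 2 * c + 1 ≤ x × x ≤ m + 3 * c)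
  ∈-target⁻ (here refl) = inj₁ refl
  ∈-target⁻ {x} (there x∈) with lo , hi ← ∈-range⁻ x∈ =
    inj₂ (subst (_≤ x) (+-comm 1 (m + 2 * c)) lo , subst (x ≤_) (sym (m+3c≡m+2c+c m c)) (≤-pred hi))

  target-unique : t ≤ m + 2 * c → Unique (t ∷ range (suc (m + 2 * c)) c)
  target-unique t≤N = All.tabulate (λ x∈ t≡x → <⇒≱ (proj₁ (∈-range⁻ x∈)) (subst (_≤ _) t≡x t≤N))
                    ∷ range-unique _ c

-- Vertex sums of S_{a,b} + c P₃

sum-allEdges : ∀ {a b c} (h : Edge a b c → ℕ) → sum (map h (allEdges a b c)) ≡
  ∑ (λ i → h (pEdge i 0F) + h (pEdge i 1F)) + (h eI + (∑ (h ∘ aEdge) + ∑ (h ∘ bEdge)))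
sum-allEdges {a} {b} {c} h = begin
  sum (map h (ps ++ eI ∷ as ++ bs))
    ≡⟨ sum-map-++ h ps _ ⟩
  sum (map h ps) + (h eI + sum (map h (as ++ bs)))
    ≡⟨ cong (λ s → sum (map h ps) + (h eI + s)) (sum-map-++ h as bs) ⟩
  sum (map h ps) + (h eI + (sum (map h as) + sum (map h bs)))
    ≡⟨ cong₂ (λ p s → p + (h eI + s)) sum-ps (cong₂ _+_ (sum-family aEdge) (sum-family bEdge)) ⟩
  ∑ (λ i → h (pEdge i 0F) + h (pEdge i 1F)) + (h eI + (∑ (h ∘ aEdge) + ∑ (h ∘ bEdge)))
    ∎
  where
  open ≡-Reasoning
  ps as bs : List (Edge a b c)
  ps = concatMap (λ i → map (pEdge i) (allFin 2)) (allFin c)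
  as = map aEdge (allFin a)
  bs = map bEdge (allFin b)
  sum-family : ∀ {n} (g : Fin n → Edge a b c) → sum (map h (map g (allFin n))) ≡ ∑ (h ∘ g)
  sum-family {n} g = trans (cong sum (sym (map-∘ {g = h} {f = g} (allFin n)))) (sum-map-allFin (h ∘ g))
  sum-ps : sum (map h ps) ≡ ∑ (λ i → h (pEdge i 0F) + h (pEdge i 1F))
  sum-ps = begin
    sum (map h ps)
      ≡⟨ sum-map-concatMap h _ (allFin c) ⟩
    sum (map (λ i → h (pEdge i 0F) + (h (pEdge i 1F) + 0)) (allFin c))
      ≡⟨ sum-map-allFin {c} _ ⟩
    ∑ (λ i → h (pEdge i 0F) + (h (pEdge i 1F) + 0))
      ≡⟨ sum-cong-≗ (λ i → cong (h (pEdge i 0F) +_) (+-identityʳ _)) ⟩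
    ∑ (λ i → h (pEdge i 0F) + h (pEdge i 1F))
      ∎

∈-allEdges : ∀ {a b c} (e : Edge a b c) → e ∈ allEdges a b c
∈-allEdges (pEdge i j) = ∈-++⁺ˡ (∈-concatMap⁺ (λ i → map (pEdge i) (allFin 2))
                                               (lose (∈-allFin i) (∈-map⁺ (pEdge i) (∈-allFin j))))
∈-allEdges eI          = ∈-++⁺ʳ _ (here refl)
∈-allEdges (aEdge k)   = ∈-++⁺ʳ _ (there (∈-++⁺ˡ (∈-map⁺ aEdge (∈-allFin k))))
∈-allEdges (bEdge k)   = ∈-++⁺ʳ _ (there (∈-++⁺ʳ _ (∈-map⁺ bEdge (∈-allFin k))))

-- The paper's u₁, …, u_{c+1}, with u_{c+1} = hubA moved to the front.
coreVertex : ∀ {a b c} → Fin (suc c) → Vertex a b c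
coreVertex zero    = hubA
coreVertex (suc i) = mid i

module _ {a b c : ℕ} (f : Edge a b c → ℕ) where

  contribution : Vertex a b c → Edge a b c → ℕ
  contribution v e = if does (incident? v e) then f e else 0

  contribution-incident : ∀ v e → Incident v e → contribution v e ≡ f e
  contribution-incident v e v∈e = cong (if_then f e else 0) (dec-true (incident? v e) v∈e)

  contribution-nonincident : ∀ v e → ¬ Incident v e → contribution v e ≡ 0
  contribution-nonincident v e v∉e = cong (if_then f e else 0) (dec-false (incident? v e) v∉e)

  φ≡∑contribution : ∀ v → φ f v ≡
    ∑ (λ i → contribution v (pEdge i 0F) + contribution v (pEdge i 1F))
      + (contribution v eI + (∑ (contribution v ∘ aEdge) + ∑ (contribution v ∘ bEdge)))
  φ≡∑contribution v =
    trans (sum-map-filter (incident? v) f (allEdges a b c)) (sum-allEdges (contribution v))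

  -- incident? v e reduces to yes or no unless it has to compare two Fin indices, so most
  -- contributions below are 0 or f e by computation alone.
  φ-hubA : φ f hubA ≡ f eI + ∑ (f ∘ aEdge)
  φ-hubA = begin
    φ f hubA
      ≡⟨ φ≡∑contribution hubA ⟩
    ∑ {c} (λ _ → 0) + (f eI + (∑ (f ∘ aEdge) + ∑ {b} (λ _ → 0)))
      ≡⟨ cong₂ (λ p q → p + (f eI + (∑ (f ∘ aEdge) + q))) (sum-replicate-zero c) (sum-replicate-zero b) ⟩
    f eI + (∑ (f ∘ aEdge) + 0)
      ≡⟨ cong (f eI +_) (+-identityʳ _) ⟩
    f eI + ∑ (f ∘ aEdge)
      ∎
    where open ≡-Reasoning

  φ-hubB : φ f hubB ≡ f eI + ∑ (f ∘ bEdge)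
  φ-hubB = begin
    φ f hubB
      ≡⟨ φ≡∑contribution hubB ⟩
    ∑ {c} (λ _ → 0) + (f eI + (∑ {a} (λ _ → 0) + ∑ (f ∘ bEdge)))
      ≡⟨ cong₂ (λ p q → p + (f eI + (q + ∑ (f ∘ bEdge)))) (sum-replicate-zero c) (sum-replicate-zero a) ⟩
    f eI + ∑ (f ∘ bEdge)
      ∎
    where open ≡-Reasoning

  φ-mid : ∀ i → φ f (mid i) ≡ f (pEdge i 0F) + f (pEdge i 1F)
  φ-mid i = begin
    φ f (mid i)
      ≡⟨ φ≡∑contribution (mid i) ⟩
    ∑ t + (∑ {a} (λ _ → 0) + ∑ {b} (λ _ → 0))
      ≡⟨ +-cong₃ (∑-single t i t≡0) (sum-replicate-zero a) (sum-replicate-zero b) ⟩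
    t i + 0
      ≡⟨ +-identityʳ (t i) ⟩
    t i
      ≡⟨ cong₂ _+_ (contribution-incident (mid i) _ (inj₁ refl)) (contribution-incident (mid i) _ (inj₁ refl)) ⟩
    f (pEdge i 0F) + f (pEdge i 1F)
      ∎
    where
    open ≡-Reasoning
    t : Vector ℕ c
    t = λ i′ → contribution (mid i) (pEdge i′ 0F) + contribution (mid i) (pEdge i′ 1F)
    t≡0 : ∀ i′ → i′ ≢ i → t i′ ≡ 0
    t≡0 i′ i′≢i = cong₂ _+_ (contribution-nonincident (mid i) (pEdge i′ 0F) elsewhere)
                            (contribution-nonincident (mid i) (pEdge i′ 1F) elsewhere)
      where
      elsewhere : ∀ {j} → ¬ Incident {a} {b} (mid i) (pEdge i′ j)
      elsewhere (inj₁ refl) = i′≢i refl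

  φ-leafP : ∀ i j → φ f (leafP i j) ≡ f (pEdge i j)
  φ-leafP i j = begin
    φ f (leafP i j)
      ≡⟨ φ≡∑contribution (leafP i j) ⟩
    ∑ t + (∑ {a} (λ _ → 0) + ∑ {b} (λ _ → 0))
      ≡⟨ +-cong₃ (∑-single t i t≡0) (sum-replicate-zero a) (sum-replicate-zero b) ⟩
    t i + 0
      ≡⟨ +-identityʳ (t i) ⟩
    t i
      ≡⟨ t-i j ⟩
    f (pEdge i j)
      ∎
    where
    open ≡-Reasoning
    t : Vector ℕ c
    t = λ i′ → contribution (leafP i j) (pEdge i′ 0F) + contribution (leafP i j) (pEdge i′ 1F)
    t≡0 : ∀ i′ → i′ ≢ i → t i′ ≡ 0
    t≡0 i′ i′≢i = cong₂ _+_ (contribution-nonincident (leafP i j) (pEdge i′ 0F) elsewhere)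
                            (contribution-nonincident (leafP i j) (pEdge i′ 1F) elsewhere)
      where
      elsewhere : ∀ {j′} → ¬ Incident {a} {b} (leafP i j) (pEdge i′ j′)
      elsewhere (inj₂ refl) = i′≢i refl
    t-i : ∀ j → contribution (leafP i j) (pEdge i 0F) + contribution (leafP i j) (pEdge i 1F)
              ≡ f (pEdge i j)
    t-i 0F = trans (cong₂ _+_ (contribution-incident (leafP i 0F) _ (inj₂ refl))
                              (contribution-nonincident (leafP i 0F) _ λ { (inj₁ ()) ; (inj₂ ()) }))
                   (+-identityʳ _)
    t-i 1F = cong₂ _+_ (contribution-nonincident (leafP i 1F) _ λ { (inj₁ ()) ; (inj₂ ()) })
                       (contribution-incident (leafP i 1F) _ (inj₂ refl))

  φ-leafA : ∀ k → φ f (leafA k) ≡ f (aEdge k)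
  φ-leafA k = begin
    φ f (leafA k)
      ≡⟨ φ≡∑contribution (leafA k) ⟩
    ∑ {c} (λ _ → 0) + (∑ t + ∑ {b} (λ _ → 0))
      ≡⟨ +-cong₃ (sum-replicate-zero c) (∑-single t k t≡0) (sum-replicate-zero b) ⟩
    t k + 0
      ≡⟨ +-identityʳ (t k) ⟩
    t k
      ≡⟨ contribution-incident (leafA k) _ (inj₂ refl) ⟩
    f (aEdge k)
      ∎
    where
    open ≡-Reasoning
    t : Vector ℕ a
    t = contribution (leafA k) ∘ aEdge
    t≡0 : ∀ k′ → k′ ≢ k → t k′ ≡ 0
    t≡0 k′ k′≢k = contribution-nonincident (leafA k) _ λ { (inj₂ refl) → k′≢k refl }

  φ-leafB : ∀ k → φ f (leafB k) ≡ f (bEdge k)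
  φ-leafB k = begin
    φ f (leafB k)
      ≡⟨ φ≡∑contribution (leafB k) ⟩
    ∑ {c} (λ _ → 0) + (∑ {a} (λ _ → 0) + ∑ t)
      ≡⟨ +-cong₃ (sum-replicate-zero c) (sum-replicate-zero a) (∑-single t k t≡0) ⟩
    t k
      ≡⟨ contribution-incident (leafB k) _ (inj₂ refl) ⟩
    f (bEdge k)
      ∎
    where
    open ≡-Reasoning
    t : Vector ℕ b
    t = contribution (leafB k) ∘ bEdge
    t≡0 : ∀ k′ → k′ ≢ k → t k′ ≡ 0
    t≡0 k′ k′≢k = contribution-nonincident (leafB k) _ λ { (inj₂ refl) → k′≢k refl }

  φ-leaf : ∀ e → e ≢ eI → φ f (proj₂ (ends e)) ≡ f e
  φ-leaf (pEdge i j) _    = φ-leafP i j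
  φ-leaf eI          e≢eI = contradiction refl e≢eI
  φ-leaf (aEdge k)   _    = φ-leafA k
  φ-leaf (bEdge k)   _    = φ-leafB k

  φ-core+φ-hubB : sum (tabulate (φ f ∘ coreVertex)) + φ f hubB ≡ sum (map f (allEdges a b c)) + f eI
  φ-core+φ-hubB = begin
    (φ f hubA + sum (tabulate (φ f ∘ mid))) + φ f hubB
      ≡⟨ cong₂ (λ p q → p + q + φ f hubB) φ-hubA (sum-tabulate (φ f ∘ mid)) ⟩
    (f eI + A) + ∑ (φ f ∘ mid) + φ f hubB
      ≡⟨ cong₂ (λ p q → (f eI + A) + p + q) (sum-cong-≗ φ-mid) φ-hubB ⟩
    (f eI + A) + P + (f eI + B)
      ≡⟨ regroup (f eI) A B P ⟩
    P + (f eI + (A + B)) + f eI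
      ≡⟨ cong (_+ f eI) (sum-allEdges f) ⟨
    sum (map f (allEdges a b c)) + f eI
      ∎
    where
    open ≡-Reasoning
    P A B : ℕ
    P = ∑ (λ i → f (pEdge i 0F) + f (pEdge i 1F))
    A = ∑ (f ∘ aEdge)
    B = ∑ (f ∘ bEdge)
    regroup : ∀ e A B P → e + A + P + (e + B) ≡ P + (e + (A + B)) + e
    regroup = solve-∀

  core-sum⁺ : ∀ {x} → (∃[ i ] φ f (mid i) ≡ x) ⊎ φ f hubA ≡ x → x ∈ tabulate (φ f ∘ coreVertex)
  core-sum⁺ (inj₁ (i , refl)) = ∈-tabulate⁺ {f = φ f ∘ coreVertex} (suc i)
  core-sum⁺ (inj₂ refl)       = ∈-tabulate⁺ {f = φ f ∘ coreVertex} zero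

  core-sum⁻ : ∀ {x} → x ∈ tabulate (φ f ∘ coreVertex) → (∃[ i ] φ f (mid i) ≡ x) ⊎ φ f hubA ≡ x
  core-sum⁻ x∈ with ∈-tabulate⁻ {f = φ f ∘ coreVertex} x∈
  ... | zero  , refl = inj₂ refl
  ... | suc i , refl = inj₁ (i , refl)

  -- All labels sum to at least 1 + ⋯ + N, while the distinct core sums lie in the target set
  -- and so sum to at most f eI + (N + 1) + ⋯ + (N + c).
  φ-hubB-lower-bound : ∀ {N} → (∀ k → 1 ≤ k → k ≤ N → ∃[ e ] f e ≡ k) →
                       Injective _≡_ _≡_ (φ f ∘ coreVertex) →
                       tabulate (φ f ∘ coreVertex) ⊆ f eI ∷ range (suc N) c →
                       sum (range 1 N) ≤ sum (range (suc N) c) + φ f hubB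
  φ-hubB-lower-bound {N} f-onto core-injective core⊆target = +-cancelˡ-≤ (f eI) _ _ (begin
    f eI + sum (range 1 N)                       ≤⟨ +-monoʳ-≤ (f eI) (sum-mono-⊆ (range-unique 1 N) labels) ⟩
    f eI + sum (map f (allEdges a b c))          ≡⟨ +-comm (f eI) _ ⟩
    sum (map f (allEdges a b c)) + f eI          ≡⟨ φ-core+φ-hubB ⟨
    sum (tabulate (φ f ∘ coreVertex)) + φ f hubB ≤⟨ +-monoˡ-≤ (φ f hubB) core-total ⟩
    f eI + sum (range (suc N) c) + φ f hubB      ≡⟨ +-assoc (f eI) _ _ ⟩
    f eI + (sum (range (suc N) c) + φ f hubB)    ∎)
    where
    open ≤-Reasoning
    labels : range 1 N ⊆ map f (allEdges a b c)
    labels k∈ with 1≤k , k<1+N ← ∈-range⁻ k∈ with e , refl ← f-onto _ 1≤k (≤-pred k<1+N) =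
      ∈-map⁺ f (∈-allEdges e)
    core-total : sum (tabulate (φ f ∘ coreVertex)) ≤ f eI + sum (range (suc N) c)
    core-total = sum-mono-⊆ (Unique.tabulate⁺ core-injective) core⊆target

data VertexView {a b c} : Vertex a b c → Set where
  core : ∀ i → VertexView (coreVertex i)
  leaf : ∀ e → e ≢ eI → VertexView (proj₂ (ends e))
  hubB : VertexView hubB

view : ∀ {a b c} (v : Vertex a b c) → VertexView v
view (mid i)     = core (suc i)
view hubA        = core zero
view (leafP i j) = leaf (pEdge i j) λ ()
view (leafA k)   = leaf (aEdge k) λ ()
view (leafB k)   = leaf (bEdge k) λ ()
view hubB        = hubB

module _ {a b c : ℕ} (f : Edge a b c → ℕ) {N : ℕ}
         (f-injective : Injective _≡_ _≡_ f) (f≤N : ∀ e → f e ≤ N)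
         (core-injective : Injective _≡_ _≡_ (φ f ∘ coreVertex))
         (core⊆target : tabulate (φ f ∘ coreVertex) ⊆ f eI ∷ range (suc N) c)
         (φ-hubB-large : N + c < φ f hubB) where

  private
    core∈target : ∀ i → φ f (coreVertex i) ∈ f eI ∷ range (suc N) c
    core∈target i = core⊆target (∈-tabulate⁺ {f = φ f ∘ coreVertex} i)

    core≢leaf : ∀ i e → e ≢ eI → φ f (coreVertex i) ≢ φ f (proj₂ (ends e))
    core≢leaf i e e≢eI eq with core∈target i
    ... | here core≡feI = e≢eI (f-injective (trans (sym (φ-leaf f e e≢eI)) (trans (sym eq) core≡feI)))
    ... | there core∈   =
      <⇒≱ (proj₁ (∈-range⁻ core∈)) (subst (_≤ N) (sym (trans eq (φ-leaf f e e≢eI))) (f≤N e))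

    core≤ : ∀ i → φ f (coreVertex i) ≤ N + c
    core≤ i with core∈target i
    ... | here core≡feI = subst (_≤ N + c) (sym core≡feI) (≤-trans (f≤N eI) (m≤m+n N c))
    ... | there core∈   = ≤-pred (proj₂ (∈-range⁻ core∈))

    leaf≤ : ∀ e → e ≢ eI → φ f (proj₂ (ends e)) ≤ N + c
    leaf≤ e e≢eI = subst (_≤ N + c) (sym (φ-leaf f e e≢eI)) (≤-trans (f≤N e) (m≤m+n N c))

    below-hubB : ∀ {v} → φ f v ≤ N + c → φ f v ≢ φ f hubB
    below-hubB v≤ eq = <⇒≱ φ-hubB-large (subst (_≤ N + c) eq v≤)

  φ-injective : ∀ u v → φ f u ≡ φ f v → u ≡ v
  φ-injective u v eq with view u | view v
  ... | core i      | core j        = cong coreVertex (core-injective eq)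
  ... | core i      | leaf e e≢eI   = contradiction eq (core≢leaf i e e≢eI)
  ... | leaf e e≢eI | core j        = contradiction (sym eq) (core≢leaf j e e≢eI)
  ... | leaf e e≢eI | leaf e′ e′≢eI =
    cong (proj₂ ∘ ends) (f-injective (trans (sym (φ-leaf f e e≢eI)) (trans eq (φ-leaf f e′ e′≢eI))))
  ... | core i      | hubB          = contradiction eq (below-hubB (core≤ i))
  ... | leaf e e≢eI | hubB          = contradiction eq (below-hubB (leaf≤ e e≢eI))
  ... | hubB        | core j        = contradiction (sym eq) (below-hubB (core≤ j))
  ... | hubB        | leaf e e≢eI   = contradiction (sym eq) (below-hubB (leaf≤ e e≢eI))
  ... | hubB        | hubB          = refl

proposition1 : (a b c : ℕ) → 1 ≤ a → 1 ≤ b → 1 ≤ c →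
    c ≤ τ₀ (a + b + 1) →
    (f : Edge a b c → ℕ) →
    IsBijectionOnto1to ((a + b + 1) + 2 * c) f →
    (∀ x → ((∃[ i ] φ f (mid i) ≡ x) ⊎ φ f hubA ≡ x)
           → (x ≡ f eI ⊎ ((a + b + 1) + 2 * c + 1 ≤ x × x ≤ (a + b + 1) + 3 * c))) →
    (∀ x → (x ≡ f eI ⊎ ((a + b + 1) + 2 * c + 1 ≤ x × x ≤ (a + b + 1) + 3 * c))
           → ((∃[ i ] φ f (mid i) ≡ x) ⊎ φ f hubA ≡ x)) →
    IsAntimagic a b c f
proposition1 a b c 1≤a 1≤b 1≤c c≤τ₀ f bij@(f-injective , f-range , f-onto) sums⊆target target⊆sums =
  bij , φ-injective f f-injective (proj₂ ∘ f-range) core-injective core⊆target φ-hubB-large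
  where
  m N : ℕ
  m = a + b + 1
  N = m + 2 * c
  core⊆target : tabulate (φ f ∘ coreVertex) ⊆ f eI ∷ range (suc N) c
  core⊆target x∈ = ∈-target⁺ m c (f eI) (sums⊆target _ (core-sum⁻ f x∈))
  target⊆core : f eI ∷ range (suc N) c ⊆ tabulate (φ f ∘ coreVertex)
  target⊆core x∈ = core-sum⁺ f (target⊆sums _ (∈-target⁻ m c (f eI) x∈))
  core-injective : Injective _≡_ _≡_ (φ f ∘ coreVertex)
  core-injective = unique-⊆-tabulate⇒injective (φ f ∘ coreVertex)
    (target-unique m c (f eI) (proj₂ (f-range eI)))
    (≤-reflexive (sym (cong suc (length-range (suc N) c)))) target⊆core
  2≤m : 2 ≤ m
  2≤m = ≤-trans (+-mono-≤ 1≤a 1≤b) (m≤m+n (a + b) 1)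
  φ-hubB-large : N + c < φ f hubB
  φ-hubB-large = +-cancelˡ-< (sum (range (suc N) c)) _ _ (<-≤-trans
    (range-gap m c (τ₀-quadratic m c 2≤m 1≤c c≤τ₀))
    (φ-hubB-lower-bound f f-onto core-injective core⊆target))
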